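{- $n(4,6,9)=35$.
   Context: All graphs are finite, simple (no loops or parallel edges) and connected. For integers $v,k,g,\lambda$, an $egr(v,k,g,\lambda)$ graph (edge-girth-regular graph) is a $k$-regular graph of girth $g$ on $v$ vertices such that every edge is contained in exactly $\lambda$ cycles of length $g$. $n(k,g,\lambda)$ denotes the smallest integer $v$ such that an $egr(v,k,g,\lambda)$ graph exists, and $n(k,g,\lambda)=\infty$ if no such graph exists. -}

module Defs where

open import Data.Nat using (ℕ; zero; suc; _≤_; _<_)
open import Data.Bool using (Bool; true; false; T)
open import Data.Fin using (Fin; toℕ)
open import Data.Vec using (Vec; []; _∷_; lookup)
open import Data.List using (List; length)
open import Data.List.Membership.Propositional using (_∈_)
open import Data.List.Relation.Unary.Unique.Propositional using (Unique)
open import Data.Product using (Σ; _×_; ∃)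
open import Function.Bundles using (_⇔_)
open import Relation.Nullary using (¬_)
open import Relation.Binary.PropositionalEquality using (_≡_)

record Graph (n : ℕ) : Set where
  field
    adj    : Fin n → Fin n → Bool
    sym    : ∀ x y → adj x y ≡ adj y x
    irrefl : ∀ x → adj x x ≡ false

module _ {n : ℕ} (G : Graph n) where
  open Graph G

  Adj : Fin n → Fin n → Set
  Adj x y = T (adj x y)

  data Reachable : Fin n → Fin n → Set where
    here : ∀ {x} → Reachable x x
    step : ∀ {x y z} → Adj x y → Reachable y z → Reachable x z

  Connected : Set
  Connected = ∀ x y → Reachable x y

  record IsCycle {m : ℕ} (c : Vec (Fin n) m) : Set where
    field
      length≥3  : 3 ≤ m
      distinct  : ∀ i j → lookup c i ≡ lookup c j → i ≡ j
      consec    : ∀ i j → suc (toℕ i) ≡ toℕ j → Adj (lookup c i) (lookup c j)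
      closing   : ∀ i j → suc (toℕ i) ≡ m → toℕ j ≡ 0 → Adj (lookup c i) (lookup c j)

HasExactly : {A : Set} → (A → Set) → ℕ → Set
HasExactly {A} P k =
  Σ (List A) λ xs → Unique xs × (∀ a → P a ⇔ (a ∈ xs)) × length xs ≡ k

module _ {n : ℕ} (G : Graph n) where

  Regular : ℕ → Set
  Regular k = ∀ x → HasExactly (Adj G x) k

  HasGirth : ℕ → Set
  HasGirth g = (Σ (Vec (Fin n) g) (IsCycle G))
             × (∀ m (c : Vec (Fin n) m) → IsCycle G c → g ≤ m)

  -- The g-cycles (as subgraphs) containing the edge xy correspond bijectively
  -- to vertex sequences x, y, r[0], ..., r[g-3] forming a cycle
  -- (each such cycle is traversed uniquely starting at x going to y).
  CycleThroughEdge : (g : ℕ) → Fin n → Fin n → Vec (Fin n) (g Data.Nat.∸ 2) → Set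
  CycleThroughEdge g x y r = IsCycle G (x ∷ y ∷ r)

  EdgeRegular : ℕ → ℕ → Set
  EdgeRegular g l = ∀ x y → Adj G x y → HasExactly (CycleThroughEdge g x y) l

  IsEGR : ℕ → ℕ → ℕ → Set
  IsEGR k g l = Connected G × Regular k × HasGirth g × EdgeRegular g l

EGRExists : ℕ → ℕ → ℕ → ℕ → Set
EGRExists v k g l = Σ (Graph v) λ G → IsEGR G k g l

nEGR≡ : ℕ → ℕ → ℕ → ℕ → Set
nEGR≡ k g l v = EGRExists v k g l × (∀ w → w < v → ¬ EGRExists w k g l)

-- Fix an edge xy of an egr(n, 4, 6, λ) graph. Because the girth is 6, the vertices
-- reached from x by non-backtracking walks of length at most 2 avoiding y, together with those
-- reached from y avoiding x, are 2 · (1 + 3 + 9) = 26 distinct vertices forming two trees. An edge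
-- between a leaf of x's tree and a leaf of y's tree closes a hexagon through xy, so there are at
-- most λ of them. Of the 18 · 4 = 72 edge-ends at the leaves, the tree vertices absorb at most
-- 0 + 0 + 9 + 9 + λ + λ and each of the n − 26 other vertices at most 4; hence
-- 72 ≤ 18 + 2λ + 4(n − 26), that is 79 ≤ λ + 2n, and λ = 9 forces n ≥ 35.
--
-- The odd graph O₄ (the Kneser graph K(7,3)) is connected, 4-regular on 35 vertices,
-- has girth 6, and each of its edges lies on exactly 9 hexagons; all of this is checked by
-- evaluation.

module Submission where

open import Defs
open import Data.Bool using (Bool; true; false; T; T?; not; _∨_; if_then_else_)
open import Data.Bool.ListAction using (all; any)
import Data.Bool.Properties as Bool
open import Data.Empty using (⊥; ⊥-elim)
open import Data.Fin using (Fin; zero; suc; toℕ; fromℕ; punchIn; cast; #_)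
import Data.Fin.Properties as Fin
open import Data.List using (List; []; _∷_; _++_; map; length; filter; allFin; concatMap; cartesianProductWith;
                             cartesianProduct)
import Data.List as List
import Data.List.Properties as List
open import Data.List.Membership.Propositional using (_∈_; lose; find)
open import Data.List.Membership.Propositional.Properties
  using (∈-allFin; ∈-lookup; ∈-filter⁺; ∈-filter⁻; ∈-∃++; ∈-++⁻; ∈-++⁺ˡ; ∈-++⁺ʳ;
         ∈-concatMap⁺; ∈-concatMap⁻; ∈-map⁺; ∈-map⁻; ∈-cartesianProductWith⁺; ∈-cartesianProductWith⁻)
open import Data.List.Relation.Binary.Disjoint.Propositional using (Disjoint)
open import Data.List.Relation.Unary.All as All using (All; []; _∷_)
import Data.List.Relation.Unary.All.Properties as All
import Data.List.Relation.Unary.AllPairs as AllPairs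
open import Data.List.Relation.Unary.AllPairs using ([]; _∷_)
import Data.List.Relation.Unary.AllPairs.Properties as AllPairs
import Data.List.Relation.Unary.Any as Any
open import Data.List.Relation.Unary.Any.Properties using (lookup-index; any⁻)
open import Data.List.Relation.Unary.Unique.Propositional using (Unique)
open import Data.List.Relation.Unary.Unique.Propositional.Properties
  using (allFin⁺; filter⁺; concat⁺; cartesianProductWith⁺; cartesianProduct⁺)
  renaming (map⁺ to Unique-map⁺)
import Data.List.Relation.Unary.Unique.DecPropositional as UniqueDec
open import Data.Nat using (ℕ; zero; suc; _+_; _*_; _≤_; _<_; _≤?_; _≟_; z≤n; s≤s)
import Data.Nat.Properties as ℕ
open import Algebra.Properties.CommutativeSemigroup ℕ.+-commutativeSemigroup using (interchange)
open import Data.Nat.Tactic.RingSolver using (solve-∀)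
open import Data.Product using (_×_; _,_; proj₁; proj₂)
import Data.Product.Properties as ×
open import Data.Sum using (_⊎_; inj₁; inj₂)
import Data.Sum.Properties as ⊎
open import Data.Unit using (⊤; tt)
import Data.Unit.Properties as ⊤
open import Data.Vec using (Vec; []; _∷_; lookup; head; last)
import Data.Vec.Properties as Vec
import Data.Vec.Relation.Unary.All as VecAll
open import Data.Vec.Relation.Unary.All using ([]; _∷_)
open import Data.Vec.Relation.Unary.AllPairs using (allPairs?; []; _∷_)
open import Data.Vec.Relation.Unary.Linked using (Linked; []; [-]; _∷_; linked?)
open import Data.Vec.Relation.Unary.Unique.Propositional using () renaming (Unique to Uniqueᵛ)
open import Data.Vec.Relation.Unary.Unique.Propositional.Properties
  using (lookup-injective; tabulate⁺) renaming (map⁺ to Uniqueᵛ-map⁺)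
open import Function using (id; _∘_; _⇔_; mk⇔; Equivalence)
open import Relation.Binary.Definitions using (DecidableEquality)
open import Relation.Binary.PropositionalEquality
  using (_≡_; _≢_; ≢-sym; refl; sym; trans; cong; cong₂; subst; module ≡-Reasoning)
open import Relation.Nullary using (Dec; yes; no; does; ¬_; ¬?)
open import Relation.Nullary.Decidable
  using (⌊_⌋; from-no; map′; _×-dec_; _→-dec_; toWitness; fromWitness; toWitnessFalse)
open import Relation.Unary using (Decidable)

byEvaluation : ∀ {A : Set} (a? : Dec A) → ⌊ a? ⌋ ≡ true → A
byEvaluation a? holds = toWitness (Equivalence.from Bool.T-≡ holds)

all-true : ∀ {A : Set} {p : A → Bool} {xs : List A} → all p xs ≡ true → ∀ {a} → a ∈ xs → T (p a)
all-true {xs = xs} holds = All.lookup (All.all⁺ _ xs (Equivalence.from Bool.T-≡ holds))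

∀-byEvaluation : ∀ {n} {P : Fin n → Set} (P? : Decidable P) →
                 all (λ x → ⌊ P? x ⌋) (allFin n) ≡ true → ∀ x → P x
∀-byEvaluation P? holds x = toWitness (all-true holds (∈-allFin x))

∀₂-byEvaluation : ∀ {n} {P : Fin n → Fin n → Set} (P? : ∀ x y → Dec (P x y)) →
                  all (λ x → all (λ y → ⌊ P? x y ⌋) (allFin n)) (allFin n) ≡ true → ∀ x y → P x y
∀₂-byEvaluation P? holds x = ∀-byEvaluation (P? x) (Equivalence.to Bool.T-≡ (all-true holds (∈-allFin x)))

-- Finite sums

∑ : ∀ {A : Set} → List A → (A → ℕ) → ℕ
∑ []       f = 0
∑ (a ∷ as) f = f a + ∑ as f

syntax ∑ xs (λ a → e) = ∑[ a ∈ xs ] e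

∑-++ : ∀ {A : Set} (xs ys : List A) f → ∑ (xs ++ ys) f ≡ ∑ xs f + ∑ ys f
∑-++ []       ys f = refl
∑-++ (x ∷ xs) ys f = trans (cong (f x +_) (∑-++ xs ys f)) (sym (ℕ.+-assoc (f x) _ _))

∑-map : ∀ {A B : Set} (g : A → B) xs f → ∑ (map g xs) f ≡ ∑ xs (f ∘ g)
∑-map g []       f = refl
∑-map g (x ∷ xs) f = cong (f (g x) +_) (∑-map g xs f)

∑-cong : ∀ {A : Set} (xs : List A) {f g} → (∀ a → f a ≡ g a) → ∑ xs f ≡ ∑ xs g
∑-cong []       _   = refl
∑-cong (x ∷ xs) f≗g = cong₂ _+_ (f≗g x) (∑-cong xs f≗g)

∑-mono : ∀ {A : Set} (xs : List A) {f g} → (∀ a → f a ≤ g a) → ∑ xs f ≤ ∑ xs g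
∑-mono []       _   = z≤n
∑-mono (x ∷ xs) f≤g = ℕ.+-mono-≤ (f≤g x) (∑-mono xs f≤g)

∑-+ : ∀ {A : Set} (xs : List A) f g → ∑[ a ∈ xs ] (f a + g a) ≡ ∑ xs f + ∑ xs g
∑-+ []       f g = refl
∑-+ (x ∷ xs) f g = trans (cong (f x + g x +_) (∑-+ xs f g)) (interchange (f x) (g x) (∑ xs f) (∑ xs g))

∑-const : ∀ {A : Set} (xs : List A) c → ∑[ _ ∈ xs ] c ≡ length xs * c
∑-const []       c = refl
∑-const (x ∷ xs) c = cong (c +_) (∑-const xs c)

∑-zero : ∀ {A : Set} (xs : List A) → ∑[ _ ∈ xs ] 0 ≡ 0
∑-zero xs = trans (∑-const xs 0) (ℕ.*-zeroʳ (length xs))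

∑-swap : ∀ {A B : Set} (xs : List A) (ys : List B) (f : A → B → ℕ) →
         ∑[ a ∈ xs ] ∑[ b ∈ ys ] f a b ≡ ∑[ b ∈ ys ] ∑[ a ∈ xs ] f a b
∑-swap []       ys f = sym (∑-zero ys)
∑-swap (x ∷ xs) ys f = trans (cong (∑ ys (f x) +_) (∑-swap xs ys f)) (sym (∑-+ ys (f x) _))

∑-cartesianProduct : ∀ {A B : Set} (xs : List A) (ys : List B) f →
                     ∑ (cartesianProduct xs ys) f ≡ ∑[ a ∈ xs ] ∑[ b ∈ ys ] f (a , b)
∑-cartesianProduct []       ys f = refl
∑-cartesianProduct (x ∷ xs) ys f =
  trans (∑-++ (map (x ,_) ys) _ f) (cong₂ _+_ (∑-map (x ,_) ys f) (∑-cartesianProduct xs ys f))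

∑-partition : ∀ {A : Set} (xs : List A) f (b : A → Bool) →
              ∑ xs f ≡ ∑[ a ∈ xs ] (if b a then f a else 0) + ∑[ a ∈ xs ] (if b a then 0 else f a)
∑-partition xs f b = trans (∑-cong xs split) (∑-+ xs _ _)
  where
  split : ∀ a → f a ≡ (if b a then f a else 0) + (if b a then 0 else f a)
  split a with b a
  ... | true  = sym (ℕ.+-identityʳ (f a))
  ... | false = refl

∑-filter : ∀ {A : Set} {P : A → Set} (P? : Decidable P) xs →
           ∑[ a ∈ xs ] (if does (P? a) then 1 else 0) ≡ length (filter P? xs)
∑-filter P? []       = refl
∑-filter P? (x ∷ xs) with does (P? x)
... | true  = cong suc (∑-filter P? xs)
... | false = ∑-filter P? xs

module _ {n : ℕ} where

  open import Data.List.Membership.DecPropositional (Fin._≟_ {n}) using (_∈?_)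

  ∑-delta : ∀ {ys : List (Fin n)} → Unique ys → ∀ {a} → a ∈ ys → ∀ (h : Fin n → ℕ) →
            ∑[ v ∈ ys ] (if does (v Fin.≟ a) then h v else 0) ≡ h a
  ∑-delta {y ∷ ys} (y∉ys ∷ unique) {a} a∈ h with y Fin.≟ a | a∈
  ... | yes refl | _              = trans (cong (h y +_) (absent ys y∉ys)) (ℕ.+-identityʳ (h y))
    where
    absent : ∀ zs → All (y ≢_) zs → ∑[ v ∈ zs ] (if does (v Fin.≟ y) then h v else 0) ≡ 0
    absent []       []          = refl
    absent (z ∷ zs) (y≢z ∷ y∉) with z Fin.≟ y
    ... | yes z≡y = ⊥-elim (y≢z (sym z≡y))
    ... | no _    = absent zs y∉
  ... | no y≢a   | Any.here a≡y   = ⊥-elim (y≢a (sym a≡y))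
  ... | no _     | Any.there a∈ys = ∑-delta unique a∈ys h

  ∑-allFin-∈ : ∀ {xs : List (Fin n)} → Unique xs → ∀ (h : Fin n → ℕ) →
               ∑[ v ∈ allFin n ] (if does (v ∈? xs) then h v else 0) ≡ ∑ xs h
  ∑-allFin-∈ {[]}     _                  h = ∑-zero (allFin n)
  ∑-allFin-∈ {a ∷ xs} unique@(a∉xs ∷ xs!) h = begin
    ∑[ v ∈ allFin n ] (if does (v ∈? (a ∷ xs)) then h v else 0)
      ≡⟨ ∑-cong (allFin n) split ⟩
    ∑[ v ∈ allFin n ] (at a v + in-xs v)
      ≡⟨ ∑-+ (allFin n) (at a) in-xs ⟩
    ∑[ v ∈ allFin n ] at a v + ∑[ v ∈ allFin n ] in-xs v
      ≡⟨ cong₂ _+_ (∑-delta (allFin⁺ n) (∈-allFin a) h) (∑-allFin-∈ xs! h) ⟩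
    h a + ∑ xs h ∎
    where
    open ≡-Reasoning
    at : Fin n → Fin n → ℕ
    at a v = if does (v Fin.≟ a) then h v else 0
    in-xs : Fin n → ℕ
    in-xs v = if does (v ∈? xs) then h v else 0
    split : ∀ v → (if does (v ∈? (a ∷ xs)) then h v else 0) ≡ at a v + in-xs v
    split v with v Fin.≟ a
    ... | no _    = refl
    ... | yes refl with v ∈? xs
    ...   | yes v∈xs = ⊥-elim (All.lookup a∉xs v∈xs refl)
    ...   | no _     = sym (ℕ.+-identityʳ (h v))

-- Lists without repetitions

Unique-⊆⇒length≤ : ∀ {A : Set} {xs ys : List A} →
                   Unique xs → (∀ {a} → a ∈ xs → a ∈ ys) → length xs ≤ length ys
Unique-⊆⇒length≤ {xs = []}     _               _     = z≤n
Unique-⊆⇒length≤ {xs = x ∷ xs} (x∉xs ∷ unique) xs⊆ys with ∈-∃++ (xs⊆ys (Any.here refl))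
... | ys₁ , ys₂ , refl = subst (suc (length xs) ≤_) (sym (List.length-++-sucʳ ys₁ x ys₂))
                               (s≤s (Unique-⊆⇒length≤ unique xs⊆ys₁++ys₂))
  where
  xs⊆ys₁++ys₂ : ∀ {a} → a ∈ xs → a ∈ ys₁ ++ ys₂
  xs⊆ys₁++ys₂ a∈xs with ∈-++⁻ ys₁ (xs⊆ys (Any.there a∈xs))
  ... | inj₁ a∈ys₁             = ∈-++⁺ˡ a∈ys₁
  ... | inj₂ (Any.here refl)   = ⊥-elim (All.lookup x∉xs a∈xs refl)
  ... | inj₂ (Any.there a∈ys₂) = ∈-++⁺ʳ ys₁ a∈ys₂

Unique⇒lookup-injective : ∀ {A : Set} {xs : List A} → Unique xs →
                          ∀ i j → List.lookup xs i ≡ List.lookup xs j → i ≡ j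
Unique⇒lookup-injective {xs = _ ∷ _}  (_ ∷ _)      zero    zero    _ = refl
Unique⇒lookup-injective {xs = _ ∷ xs} (x∉xs ∷ _)   zero    (suc j) e = ⊥-elim (All.lookup x∉xs (∈-lookup j) e)
Unique⇒lookup-injective {xs = _ ∷ xs} (x∉xs ∷ _)   (suc i) zero    e = ⊥-elim (All.lookup x∉xs (∈-lookup i) (sym e))
Unique⇒lookup-injective {xs = _ ∷ _}  (_ ∷ unique) (suc i) (suc j) e =
  cong suc (Unique⇒lookup-injective unique i j e)

HasExactly-filter : ∀ {A : Set} {P Q : A → Set} (Q? : Decidable Q) {xs : List A} →
                    Unique xs → (∀ a → P a ⇔ (a ∈ xs × Q a)) → HasExactly P (length (filter Q? xs))
HasExactly-filter {P = P} Q? {xs} unique spec =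
  filter Q? xs , filter⁺ Q? unique , (λ a → mk⇔ (to a) (from a)) , refl
  where
  to : ∀ a → P a → a ∈ filter Q? xs
  to a p = let a∈xs , q = Equivalence.to (spec a) p in ∈-filter⁺ Q? a∈xs q
  from : ∀ a → a ∈ filter Q? xs → P a
  from a a∈ = Equivalence.from (spec a) (∈-filter⁻ Q? a∈)

record OthersThan {A : Set} (P : A → Set) (u : A) (k : ℕ) : Set where
  field
    member    : Fin k → A
    member∈   : ∀ i → P (member i)
    member≢   : ∀ i → member i ≢ u
    injective : ∀ {i j} → member i ≡ member j → i ≡ j

othersThan : ∀ {A : Set} {P : A → Set} {k u} → HasExactly P (suc k) → P u → OthersThan P u k
othersThan {A = A} {k = k} {u} (xs , unique , members , len) Pu = record
  { member    = member ∘ punchIn position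
  ; member∈   = λ i → Equivalence.from (members _) (∈-lookup {xs = xs} _)
  ; member≢   = λ i e → Fin.punchInᵢ≢i position i (member-injective (trans e (sym member-position)))
  ; injective = Fin.punchIn-injective position _ _ ∘ member-injective
  }
  where
  member : Fin (suc k) → A
  member = List.lookup xs ∘ cast (sym len)
  member-injective : ∀ {i j} → member i ≡ member j → i ≡ j
  member-injective {i} {j} e = Fin.toℕ-injective (begin
    toℕ i                  ≡⟨ sym (Fin.toℕ-cast (sym len) i) ⟩
    toℕ (cast (sym len) i) ≡⟨ cong toℕ (Unique⇒lookup-injective unique _ _ e) ⟩
    toℕ (cast (sym len) j) ≡⟨ Fin.toℕ-cast (sym len) j ⟩
    toℕ j                  ∎)
    where open ≡-Reasoning
  u∈xs : u ∈ xs
  u∈xs = Equivalence.to (members u) Pu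
  position : Fin (suc k)
  position = cast len (Any.index u∈xs)
  member-position : member position ≡ u
  member-position =
    trans (cong (List.lookup xs) (Fin.cast-involutive (sym len) len _)) (sym (lookup-index u∈xs))

-- Cycles as duplicate-free closed walks

module _ {a r} {A : Set a} {R : A → A → Set r} where

  Linked⇒consecutive : ∀ {m} {v : Vec A m} → Linked R v →
                       ∀ i j → suc (toℕ i) ≡ toℕ j → R (lookup v i) (lookup v j)
  Linked⇒consecutive {v = _ ∷ _ ∷ _} (r ∷ _)  zero    (suc zero)    _ = r
  Linked⇒consecutive {v = _ ∷ _ ∷ _} (_ ∷ rs) (suc i) (suc j)       e = Linked⇒consecutive rs i j (ℕ.suc-injective e)
  Linked⇒consecutive {v = _ ∷ _ ∷ _} (_ ∷ _)  zero    (suc (suc _)) ()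

  consecutive⇒Linked : ∀ {m} {v : Vec A m} →
                       (∀ i j → suc (toℕ i) ≡ toℕ j → R (lookup v i) (lookup v j)) → Linked R v
  consecutive⇒Linked {v = []}        _ = []
  consecutive⇒Linked {v = _ ∷ []}    _ = [-]
  consecutive⇒Linked {v = _ ∷ _ ∷ _} r =
    r zero (suc zero) refl ∷ consecutive⇒Linked (λ i j e → r (suc i) (suc j) (cong suc e))

lookup-last : ∀ {a} {A : Set a} {m} (v : Vec A (suc m)) i → suc (toℕ i) ≡ suc m → lookup v i ≡ last v
lookup-last (_ ∷ [])    zero    _ = refl
lookup-last (_ ∷ _ ∷ _) (suc i) e = lookup-last _ i (ℕ.suc-injective e)

lookup-injective⇒Uniqueᵛ : ∀ {a} {A : Set a} {m} (v : Vec A m) →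
                           (∀ i j → lookup v i ≡ lookup v j → i ≡ j) → Uniqueᵛ v
lookup-injective⇒Uniqueᵛ v inj = subst Uniqueᵛ (Vec.tabulate∘lookup v) (tabulate⁺ (inj _ _))

module _ {n : ℕ} (G : Graph n) where

  Adj-sym : ∀ {x y} → Adj G x y → Adj G y x
  Adj-sym {x} {y} = subst T (Graph.sym G x y)

  Adj⇒≢ : ∀ {x y} → Adj G x y → x ≢ y
  Adj⇒≢ {x} xy refl = subst T (Graph.irrefl G x) xy

  adj? : ∀ x y → Dec (Adj G x y)
  adj? x y = T? (Graph.adj G x y)

  IsCycle-intro : ∀ {m} {c : Vec (Fin n) (3 + m)} →
                  Uniqueᵛ c → Linked (Adj G) c → Adj G (last c) (head c) → IsCycle G c
  IsCycle-intro {c = c@(_ ∷ _)} unique linked closing = record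
    { length≥3 = s≤s (s≤s (s≤s z≤n))
    ; distinct = lookup-injective unique
    ; consec   = Linked⇒consecutive linked
    ; closing  = λ { i zero e _ → subst (λ v → Adj G v (head c)) (sym (lookup-last c i e)) closing }
    }

  IsCycle-elim : ∀ {m} {c : Vec (Fin n) (suc m)} →
                 IsCycle G c → Uniqueᵛ c × Linked (Adj G) c × Adj G (last c) (head c)
  IsCycle-elim {m} {c@(_ ∷ _)} cycle =
    lookup-injective⇒Uniqueᵛ c distinct ,
    consecutive⇒Linked consec ,
    subst (λ v → Adj G v (head c)) (lookup-last c (fromℕ m) last≡) (closing (fromℕ m) zero last≡ refl)
    where
    open IsCycle cycle
    last≡ : suc (toℕ (fromℕ m)) ≡ suc m
    last≡ = cong suc (Fin.toℕ-fromℕ m)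

  isCycle? : ∀ {m} (c : Vec (Fin n) (3 + m)) → Dec (IsCycle G c)
  isCycle? c = map′ (λ (u , l , a) → IsCycle-intro u l a) IsCycle-elim
    (allPairs? (λ x y → ¬? (x Fin.≟ y)) c ×-dec linked? adj? c ×-dec adj? (last c) (head c))

  NoCycleOfLength : ℕ → Set
  NoCycleOfLength m = ∀ (c : Vec (Fin n) m) → ¬ IsCycle G c

  girth≥ : ∀ g → (∀ k → 3 + k < g → NoCycleOfLength (3 + k)) →
           ∀ m (c : Vec (Fin n) m) → IsCycle G c → g ≤ m
  girth≥ g short m c cycle with IsCycle.length≥3 cycle | g ≤? m
  ... | _                         | yes g≤m = g≤m
  ... | s≤s (s≤s (s≤s {n = k} _)) | no g≰m  = ⊥-elim (short k (ℕ.≰⇒> g≰m) c cycle)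

  Reachable-trans : ∀ {x y z} → Reachable G x y → Reachable G y z → Reachable G x z
  Reachable-trans here         yz = yz
  Reachable-trans (step xw wy) yz = step xw (Reachable-trans wy yz)

  Reachable-sym : ∀ {x y} → Reachable G x y → Reachable G y x
  Reachable-sym here         = here
  Reachable-sym (step xw wy) = Reachable-trans (Reachable-sym wy) (step (Adj-sym xw) here)

  connected : ∀ {b} → (∀ x → Reachable G x b) → Connected G
  connected toBase x y = Reachable-trans (toBase x) (Reachable-sym (toBase y))

-- The lower bound

module LowerBound {n : ℕ} (G : Graph n) (regular : Regular G 4)
                  (girth : ∀ m (c : Vec (Fin n) m) → IsCycle G c → 6 ≤ m) where

  no-triangle : ∀ {a b c} → Adj G a b → Adj G b c → Adj G c a → ⊥
  no-triangle ab bc ca = from-no (6 ≤? 3) (girth _ _ (IsCycle-intro G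
    ((Adj⇒≢ G ab ∷ ≢-sym (Adj⇒≢ G ca) ∷ []) ∷ (Adj⇒≢ G bc ∷ []) ∷ [] ∷ [])
    (ab ∷ bc ∷ [-]) ca))

  no-square : ∀ {a b c d} → Adj G a b → Adj G b c → Adj G c d → Adj G d a → a ≢ c → b ≢ d → ⊥
  no-square ab bc cd da a≢c b≢d = from-no (6 ≤? 4) (girth _ _ (IsCycle-intro G
    ((Adj⇒≢ G ab ∷ a≢c ∷ ≢-sym (Adj⇒≢ G da) ∷ []) ∷ (Adj⇒≢ G bc ∷ b≢d ∷ []) ∷
     (Adj⇒≢ G cd ∷ []) ∷ [] ∷ [])
    (ab ∷ bc ∷ cd ∷ [-]) da))

  no-pentagon : ∀ {a b c d e} → Adj G a b → Adj G b c → Adj G c d → Adj G d e → Adj G e a →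
                a ≢ c → a ≢ d → b ≢ d → b ≢ e → c ≢ e → ⊥
  no-pentagon ab bc cd de ea a≢c a≢d b≢d b≢e c≢e = from-no (6 ≤? 5) (girth _ _ (IsCycle-intro G
    ((Adj⇒≢ G ab ∷ a≢c ∷ a≢d ∷ ≢-sym (Adj⇒≢ G ea) ∷ []) ∷ (Adj⇒≢ G bc ∷ b≢d ∷ b≢e ∷ []) ∷
     (Adj⇒≢ G cd ∷ c≢e ∷ []) ∷ (Adj⇒≢ G de ∷ []) ∷ [] ∷ [])
    (ab ∷ bc ∷ cd ∷ de ∷ [-]) ea))

  open import Data.List.Membership.DecPropositional (Fin._≟_ {n}) using (_∈?_)

  edge : Fin n → Fin n → ℕ
  edge v w = if Graph.adj G v w then 1 else 0

  degreeIn : Fin n → List (Fin n) → ℕ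
  degreeIn v ws = ∑[ w ∈ ws ] edge v w

  edge-sym : ∀ v w → edge v w ≡ edge w v
  edge-sym v w = cong (λ b → if b then 1 else 0) (Graph.sym G v w)

  edge≡1 : ∀ {v w} → Adj G v w → edge v w ≡ 1
  edge≡1 {v} {w} vw rewrite Equivalence.to Bool.T-≡ vw = refl

  edge≡0 : ∀ {v w} → ¬ Adj G v w → edge v w ≡ 0
  edge≡0 {v} {w} v≁w with Graph.adj G v w
  ... | true  = ⊥-elim (v≁w tt)
  ... | false = refl

  degreeIn-neighbours : ∀ {v ws} → All (Adj G v) ws → degreeIn v ws ≡ length ws
  degreeIn-neighbours []          = refl
  degreeIn-neighbours (vw ∷ vws) = cong₂ _+_ (edge≡1 vw) (degreeIn-neighbours vws)

  degree : ∀ v → degreeIn v (allFin n) ≡ 4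
  degree v with regular v
  ... | ws , unique , members , len = begin
    ∑[ w ∈ allFin n ] edge v w                           ≡⟨ ∑-cong (allFin n) edge≡member ⟩
    ∑[ w ∈ allFin n ] (if does (w ∈? ws) then 1 else 0) ≡⟨ ∑-allFin-∈ unique (λ _ → 1) ⟩
    ∑[ _ ∈ ws ] 1                                        ≡⟨ ∑-const ws 1 ⟩
    length ws * 1                                        ≡⟨ ℕ.*-identityʳ _ ⟩
    length ws                                            ≡⟨ len ⟩
    4                                                    ∎
    where
    open ≡-Reasoning
    edge≡member : ∀ w → edge v w ≡ (if does (w ∈? ws) then 1 else 0)
    edge≡member w with w ∈? ws
    ... | yes w∈ws = edge≡1 (Equivalence.from (members w) w∈ws)
    ... | no  w∉ws = edge≡0 (w∉ws ∘ Equivalence.to (members w))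

  degreeIn≤4 : ∀ v {ws} → Unique ws → degreeIn v ws ≤ 4
  degreeIn≤4 v {ws} unique = begin
    ∑[ w ∈ ws ] edge v w
      ≡⟨ sym (∑-allFin-∈ unique (edge v)) ⟩
    ∑[ w ∈ allFin n ] (if does (w ∈? ws) then edge v w else 0)
      ≤⟨ ∑-mono (allFin n) (λ w → if≤ (does (w ∈? ws))) ⟩
    ∑[ w ∈ allFin n ] edge v w
      ≡⟨ degree v ⟩
    4 ∎
    where
    open ℕ.≤-Reasoning
    if≤ : ∀ b {m} → (if b then m else 0) ≤ m
    if≤ true  = ℕ.≤-refl
    if≤ false = z≤n

  module Branch {x y : Fin n} (xy : Adj G x y) where

    open OthersThan (othersThan (regular x) xy) public
      renaming (member to P; member∈ to x~P; member≢ to P≢y; injective to P-injective)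

    private
      module Grandchildren i = OthersThan (othersThan (regular (P i)) (Adj-sym G (x~P i)))

    A : Fin 3 → Fin 3 → Fin n
    A i = Grandchildren.member i

    P~A : ∀ i j → Adj G (P i) (A i j)
    P~A i = Grandchildren.member∈ i

    A≢x : ∀ i j → A i j ≢ x
    A≢x i = Grandchildren.member≢ i

    A≢P : ∀ i j k → A i j ≢ P k
    A≢P i j k e = no-triangle (x~P i) (subst (Adj G (P i)) e (P~A i j)) (Adj-sym G (x~P k))

    A≢y : ∀ i j → A i j ≢ y
    A≢y i j e = no-triangle (x~P i) (subst (Adj G (P i)) e (P~A i j)) (Adj-sym G xy)

    A-injective : ∀ {i j k l} → A i j ≡ A k l → i ≡ k × j ≡ l
    A-injective {i} {j} {k} {l} e with i Fin.≟ k
    ... | yes refl = refl , Grandchildren.injective i e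
    ... | no i≢k   = ⊥-elim (no-square (x~P i) (P~A i j) (subst (λ v → Adj G v (P k)) (sym e) (Adj-sym G (P~A k l)))
                                       (Adj-sym G (x~P k)) (≢-sym (A≢x i j)) (i≢k ∘ P-injective))

    A≁A : ∀ i j k l → ¬ Adj G (A i j) (A k l)
    A≁A i j k l a with i Fin.≟ k
    ... | yes refl = no-triangle (P~A i j) a (Adj-sym G (P~A i l))
    ... | no i≢k   = no-pentagon (x~P i) (P~A i j) a (Adj-sym G (P~A k l)) (Adj-sym G (x~P k))
                                 (≢-sym (A≢x i j)) (≢-sym (A≢x k l)) (≢-sym (A≢P k l i))
                                 (i≢k ∘ P-injective) (A≢P i j k)

    P≢y-child : ∀ {q} → Adj G y q → ∀ i → P i ≢ q
    P≢y-child yq i e = no-triangle (subst (Adj G x) e (x~P i)) (Adj-sym G yq) (Adj-sym G xy)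

    P≢y-grandchild : ∀ {q b} → Adj G y q → q ≢ x → Adj G q b → b ≢ y → ∀ i → P i ≢ b
    P≢y-grandchild yq q≢x qb b≢y i e =
      no-square (subst (Adj G x) e (x~P i)) (Adj-sym G qb) (Adj-sym G yq) (Adj-sym G xy) (≢-sym q≢x) b≢y

    A≢y-grandchild : ∀ {q b} → Adj G y q → q ≢ x → Adj G q b → b ≢ y → ∀ i j → A i j ≢ b
    A≢y-grandchild yq q≢x qb b≢y i j e =
      no-pentagon (x~P i) (subst (Adj G (P i)) e (P~A i j)) (Adj-sym G qb) (Adj-sym G yq) (Adj-sym G xy)
                  (subst (x ≢_) e (≢-sym (A≢x i j))) (≢-sym q≢x) (P≢y-child yq i) (P≢y i) b≢y

  module Tree {x y : Fin n} (xy : Adj G x y) {l} (hexagons : HasExactly (CycleThroughEdge G 6 x y) l) where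

    module X = Branch xy
    module Y = Branch (Adj-sym G xy)

    -- The 26 vertices of the two trees, encoded as a sum type so that node equality is decidable.
    Node : Set
    Node = ⊤ ⊎ ⊤ ⊎ Fin 3 ⊎ Fin 3 ⊎ Fin 3 × Fin 3 ⊎ Fin 3 × Fin 3

    pattern rootˣ    = inj₁ tt
    pattern rootʸ    = inj₂ (inj₁ tt)
    pattern childˣ i = inj₂ (inj₂ (inj₁ i))
    pattern childʸ i = inj₂ (inj₂ (inj₂ (inj₁ i)))
    pattern leafˣ p  = inj₂ (inj₂ (inj₂ (inj₂ (inj₁ p))))
    pattern leafʸ p  = inj₂ (inj₂ (inj₂ (inj₂ (inj₂ p))))

    _≟ᴺ_ : DecidableEquality Node
    _≟ᴺ_ = ⊎.≡-dec ⊤._≟_ (⊎.≡-dec ⊤._≟_ (⊎.≡-dec Fin._≟_ (⊎.≡-dec Fin._≟_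
             (⊎.≡-dec (×.≡-dec Fin._≟_ Fin._≟_) (×.≡-dec Fin._≟_ Fin._≟_)))))

    vertex : Node → Fin n
    vertex rootˣ           = x
    vertex rootʸ           = y
    vertex (childˣ i)      = X.P i
    vertex (childʸ i)      = Y.P i
    vertex (leafˣ (i , j)) = X.A i j
    vertex (leafʸ (i , j)) = Y.A i j

    private
      XP≢YP : ∀ i k → X.P i ≢ Y.P k
      XP≢YP i k = X.P≢y-child (Y.x~P k) i
      XP≢YA : ∀ i k m → X.P i ≢ Y.A k m
      XP≢YA i k m = X.P≢y-grandchild (Y.x~P k) (Y.P≢y k) (Y.P~A k m) (Y.A≢x k m) i
      YP≢XA : ∀ k i j → Y.P k ≢ X.A i j
      YP≢XA k i j = Y.P≢y-grandchild (X.x~P i) (X.P≢y i) (X.P~A i j) (X.A≢x i j) k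
      XA≢YA : ∀ i j k m → X.A i j ≢ Y.A k m
      XA≢YA i j k m = X.A≢y-grandchild (Y.x~P k) (Y.P≢y k) (Y.P~A k m) (Y.A≢x k m) i j

    vertex-injective : ∀ {a b} → vertex a ≡ vertex b → a ≡ b
    vertex-injective {rootˣ}         {rootˣ}         _ = refl
    vertex-injective {rootˣ}         {rootʸ}         e = ⊥-elim (Adj⇒≢ G xy e)
    vertex-injective {rootˣ}         {childˣ i}      e = ⊥-elim (Adj⇒≢ G (X.x~P i) e)
    vertex-injective {rootˣ}         {childʸ i}      e = ⊥-elim (Y.P≢y i (sym e))
    vertex-injective {rootˣ}         {leafˣ (i , j)} e = ⊥-elim (X.A≢x i j (sym e))
    vertex-injective {rootˣ}         {leafʸ (i , j)} e = ⊥-elim (Y.A≢y i j (sym e))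
    vertex-injective {rootʸ}         {rootˣ}         e = ⊥-elim (Adj⇒≢ G xy (sym e))
    vertex-injective {rootʸ}         {rootʸ}         _ = refl
    vertex-injective {rootʸ}         {childˣ i}      e = ⊥-elim (X.P≢y i (sym e))
    vertex-injective {rootʸ}         {childʸ i}      e = ⊥-elim (Adj⇒≢ G (Y.x~P i) e)
    vertex-injective {rootʸ}         {leafˣ (i , j)} e = ⊥-elim (X.A≢y i j (sym e))
    vertex-injective {rootʸ}         {leafʸ (i , j)} e = ⊥-elim (Y.A≢x i j (sym e))
    vertex-injective {childˣ i}      {rootˣ}         e = ⊥-elim (Adj⇒≢ G (X.x~P i) (sym e))
    vertex-injective {childˣ i}      {rootʸ}         e = ⊥-elim (X.P≢y i e)
    vertex-injective {childˣ i}      {childˣ k}      e = cong childˣ (X.P-injective e)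
    vertex-injective {childˣ i}      {childʸ k}      e = ⊥-elim (XP≢YP i k e)
    vertex-injective {childˣ i}      {leafˣ (k , m)} e = ⊥-elim (X.A≢P k m i (sym e))
    vertex-injective {childˣ i}      {leafʸ (k , m)} e = ⊥-elim (XP≢YA i k m e)
    vertex-injective {childʸ i}      {rootˣ}         e = ⊥-elim (Y.P≢y i e)
    vertex-injective {childʸ i}      {rootʸ}         e = ⊥-elim (Adj⇒≢ G (Y.x~P i) (sym e))
    vertex-injective {childʸ i}      {childˣ k}      e = ⊥-elim (XP≢YP k i (sym e))
    vertex-injective {childʸ i}      {childʸ k}      e = cong childʸ (Y.P-injective e)
    vertex-injective {childʸ i}      {leafˣ (k , m)} e = ⊥-elim (YP≢XA i k m e)
    vertex-injective {childʸ i}      {leafʸ (k , m)} e = ⊥-elim (Y.A≢P k m i (sym e))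
    vertex-injective {leafˣ (i , j)} {rootˣ}         e = ⊥-elim (X.A≢x i j e)
    vertex-injective {leafˣ (i , j)} {rootʸ}         e = ⊥-elim (X.A≢y i j e)
    vertex-injective {leafˣ (i , j)} {childˣ k}      e = ⊥-elim (X.A≢P i j k e)
    vertex-injective {leafˣ (i , j)} {childʸ k}      e = ⊥-elim (YP≢XA k i j (sym e))
    vertex-injective {leafˣ (i , j)} {leafˣ (k , m)} e with X.A-injective e
    ... | refl , refl = refl
    vertex-injective {leafˣ (i , j)} {leafʸ (k , m)} e = ⊥-elim (XA≢YA i j k m e)
    vertex-injective {leafʸ (i , j)} {rootˣ}         e = ⊥-elim (Y.A≢y i j e)
    vertex-injective {leafʸ (i , j)} {rootʸ}         e = ⊥-elim (Y.A≢x i j e)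
    vertex-injective {leafʸ (i , j)} {childˣ k}      e = ⊥-elim (XP≢YA k i j (sym e))
    vertex-injective {leafʸ (i , j)} {childʸ k}      e = ⊥-elim (Y.A≢P i j k e)
    vertex-injective {leafʸ (i , j)} {leafˣ (k , m)} e = ⊥-elim (XA≢YA k m i j (sym e))
    vertex-injective {leafʸ (i , j)} {leafʸ (k , m)} e with Y.A-injective e
    ... | refl , refl = refl

    open import Data.List.Relation.Unary.Unique.DecPropositional _≟ᴺ_ using () renaming (unique? to uniqueᴺ?)

    distinct : ∀ ms → ⌊ uniqueᴺ? ms ⌋ ≡ true → Unique (map vertex ms)
    distinct ms u = Unique-map⁺ vertex-injective (byEvaluation (uniqueᴺ? ms) u)

    pairs : List (Fin 3 × Fin 3)
    pairs = cartesianProduct (allFin 3) (allFin 3)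

    leafNodes : List Node
    leafNodes = map leafˣ pairs ++ map leafʸ pairs

    nodes : List Node
    nodes = rootˣ ∷ rootʸ ∷ map childˣ (allFin 3) ++ map childʸ (allFin 3) ++ leafNodes

    leafDegree : Fin n → ℕ
    leafDegree v = degreeIn v (map vertex leafNodes)

    leafDegree+length≤4 : ∀ v ms → ⌊ uniqueᴺ? (leafNodes ++ ms) ⌋ ≡ true →
                          All (Adj G v) (map vertex ms) → leafDegree v + length ms ≤ 4
    leafDegree+length≤4 v ms u adjacent = begin
      leafDegree v + length ms
        ≡⟨ cong (leafDegree v +_) (sym (trans (degreeIn-neighbours adjacent) (List.length-map vertex ms))) ⟩
      leafDegree v + degreeIn v (map vertex ms)
        ≡⟨ sym (∑-++ (map vertex leafNodes) (map vertex ms) (edge v)) ⟩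
      degreeIn v (map vertex leafNodes ++ map vertex ms)
        ≡⟨ cong (degreeIn v) (sym (List.map-++ vertex leafNodes ms)) ⟩
      degreeIn v (map vertex (leafNodes ++ ms))
        ≤⟨ degreeIn≤4 v (distinct (leafNodes ++ ms) u) ⟩
      4 ∎
      where open ℕ.≤-Reasoning

    leafDegree-x : leafDegree x ≤ 0
    leafDegree-x = ℕ.+-cancelʳ-≤ 4 (leafDegree x) 0
      (leafDegree+length≤4 x (rootʸ ∷ map childˣ (allFin 3)) refl
                           (xy ∷ X.x~P zero ∷ X.x~P (suc zero) ∷ X.x~P (suc (suc zero)) ∷ []))

    leafDegree-y : leafDegree y ≤ 0
    leafDegree-y = ℕ.+-cancelʳ-≤ 4 (leafDegree y) 0
      (leafDegree+length≤4 y (rootˣ ∷ map childʸ (allFin 3)) refl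
                           (Adj-sym G xy ∷ Y.x~P zero ∷ Y.x~P (suc zero) ∷ Y.x~P (suc (suc zero)) ∷ []))

    leafDegree-childˣ : ∀ i → leafDegree (X.P i) ≤ 3
    leafDegree-childˣ i = ℕ.+-cancelʳ-≤ 1 (leafDegree (X.P i)) 3
                            (leafDegree+length≤4 (X.P i) (rootˣ ∷ []) refl (Adj-sym G (X.x~P i) ∷ []))

    leafDegree-childʸ : ∀ i → leafDegree (Y.P i) ≤ 3
    leafDegree-childʸ i = ℕ.+-cancelʳ-≤ 1 (leafDegree (Y.P i)) 3
                            (leafDegree+length≤4 (Y.P i) (rootʸ ∷ []) refl (Adj-sym G (Y.x~P i) ∷ []))

    leafDegree-split : ∀ v → leafDegree v ≡
                       ∑[ p ∈ pairs ] edge v (vertex (leafˣ p)) + ∑[ q ∈ pairs ] edge v (vertex (leafʸ q))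
    leafDegree-split v = begin
      degreeIn v (map vertex leafNodes)
        ≡⟨ cong (degreeIn v) (List.map-++ vertex (map leafˣ pairs) (map leafʸ pairs)) ⟩
      degreeIn v (map vertex (map leafˣ pairs) ++ map vertex (map leafʸ pairs))
        ≡⟨ ∑-++ (map vertex (map leafˣ pairs)) (map vertex (map leafʸ pairs)) (edge v) ⟩
      degreeIn v (map vertex (map leafˣ pairs)) + degreeIn v (map vertex (map leafʸ pairs))
        ≡⟨ cong₂ _+_ (leaves leafˣ) (leaves leafʸ) ⟩
      ∑[ p ∈ pairs ] edge v (vertex (leafˣ p)) + ∑[ q ∈ pairs ] edge v (vertex (leafʸ q)) ∎
      where
      open ≡-Reasoning
      leaves : ∀ (leaf : Fin 3 × Fin 3 → Node) →
               degreeIn v (map vertex (map leaf pairs)) ≡ ∑[ p ∈ pairs ] edge v (vertex (leaf p))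
      leaves leaf = trans (∑-map vertex (map leaf pairs) (edge v)) (∑-map leaf pairs (edge v ∘ vertex))

    crossEdges : ℕ
    crossEdges = ∑[ p ∈ pairs ] ∑[ q ∈ pairs ] edge (vertex (leafˣ p)) (vertex (leafʸ q))

    leafDegree-leavesˣ : ∑[ p ∈ pairs ] leafDegree (vertex (leafˣ p)) ≡ crossEdges
    leafDegree-leavesˣ = ∑-cong pairs λ p →
      trans (leafDegree-split (vertex (leafˣ p))) (cong (_+ crossFrom p) (no-edges p))
      where
      crossFrom : Fin 3 × Fin 3 → ℕ
      crossFrom p = ∑[ q ∈ pairs ] edge (vertex (leafˣ p)) (vertex (leafʸ q))
      no-edge : ∀ p p′ → edge (vertex (leafˣ p)) (vertex (leafˣ p′)) ≡ 0
      no-edge (i , j) (k , m) = edge≡0 (X.A≁A i j k m)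
      no-edges : ∀ p → ∑[ p′ ∈ pairs ] edge (vertex (leafˣ p)) (vertex (leafˣ p′)) ≡ 0
      no-edges p = trans (∑-cong pairs (no-edge p)) (∑-zero pairs)

    leafDegree-leavesʸ : ∑[ q ∈ pairs ] leafDegree (vertex (leafʸ q)) ≡ crossEdges
    leafDegree-leavesʸ = begin
      ∑[ q ∈ pairs ] leafDegree (vertex (leafʸ q))
        ≡⟨ ∑-cong pairs (λ q → trans (leafDegree-split (vertex (leafʸ q)))
                                      (trans (cong (crossTo q +_) (no-edges q)) (ℕ.+-identityʳ (crossTo q)))) ⟩
      ∑[ q ∈ pairs ] ∑[ p ∈ pairs ] edge (vertex (leafʸ q)) (vertex (leafˣ p))
        ≡⟨ ∑-swap pairs pairs (λ q p → edge (vertex (leafʸ q)) (vertex (leafˣ p))) ⟩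
      ∑[ p ∈ pairs ] ∑[ q ∈ pairs ] edge (vertex (leafʸ q)) (vertex (leafˣ p))
        ≡⟨ ∑-cong pairs (λ p → ∑-cong pairs (λ q → edge-sym (vertex (leafʸ q)) (vertex (leafˣ p)))) ⟩
      crossEdges ∎
      where
      open ≡-Reasoning
      crossTo : Fin 3 × Fin 3 → ℕ
      crossTo q = ∑[ p ∈ pairs ] edge (vertex (leafʸ q)) (vertex (leafˣ p))
      no-edge : ∀ q q′ → edge (vertex (leafʸ q)) (vertex (leafʸ q′)) ≡ 0
      no-edge (i , j) (k , m) = edge≡0 (Y.A≁A i j k m)
      no-edges : ∀ q → ∑[ q′ ∈ pairs ] edge (vertex (leafʸ q)) (vertex (leafʸ q′)) ≡ 0
      no-edges q = trans (∑-cong pairs (no-edge q)) (∑-zero pairs)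

    hexagon : (Fin 3 × Fin 3) × (Fin 3 × Fin 3) → Vec (Fin n) 4
    hexagon ((i , j) , (k , m)) = Y.P k ∷ Y.A k m ∷ X.A i j ∷ X.P i ∷ []

    hexagon-injective : ∀ {t t′} → hexagon t ≡ hexagon t′ → t ≡ t′
    hexagon-injective {(i , j) , (k , m)} {(i′ , j′) , (k′ , m′)} e
      with Y.A-injective (cong (λ v → lookup v (suc zero)) e)
         | X.A-injective (cong (λ v → lookup v (suc (suc zero))) e)
    ... | refl , refl | refl , refl = refl

    hexagon-cycle : ∀ p q → Adj G (vertex (leafˣ p)) (vertex (leafʸ q)) →
                    IsCycle G (x ∷ y ∷ hexagon (p , q))
    hexagon-cycle (i , j) (k , m) ab = IsCycle-intro G
      (Uniqueᵛ-map⁺ vertex-injective (byEvaluation (allPairs? (λ a b → ¬? (a ≟ᴺ b))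
        (rootˣ ∷ rootʸ ∷ childʸ k ∷ leafʸ (k , m) ∷ leafˣ (i , j) ∷ childˣ i ∷ [])) refl))
      (xy ∷ Y.x~P k ∷ Y.P~A k m ∷ Adj-sym G ab ∷ Adj-sym G (X.P~A i j) ∷ [-])
      (Adj-sym G (X.x~P i))

    crossEdges≤l : crossEdges ≤ l
    crossEdges≤l = begin
      crossEdges
        ≡⟨ sym (∑-cartesianProduct pairs pairs λ t → edge (vertex (leafˣ (proj₁ t))) (vertex (leafʸ (proj₂ t)))) ⟩
      ∑[ t ∈ cartesianProduct pairs pairs ] (if does (adjacent? t) then 1 else 0)
        ≡⟨ ∑-filter adjacent? (cartesianProduct pairs pairs) ⟩
      length crossing
        ≡⟨ sym (List.length-map hexagon crossing) ⟩
      length (map hexagon crossing)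
        ≤⟨ Unique-⊆⇒length≤ (Unique-map⁺ hexagon-injective (filter⁺ adjacent? (cartesianProduct⁺ pairs! pairs!)))
             ⊆cycles ⟩
      length (proj₁ hexagons)
        ≡⟨ proj₂ (proj₂ (proj₂ hexagons)) ⟩
      l ∎
      where
      open ℕ.≤-Reasoning
      adjacent? : ∀ t → Dec (Adj G (vertex (leafˣ (proj₁ t))) (vertex (leafʸ (proj₂ t))))
      adjacent? (p , q) = adj? G (vertex (leafˣ p)) (vertex (leafʸ q))
      crossing : List ((Fin 3 × Fin 3) × (Fin 3 × Fin 3))
      crossing = filter adjacent? (cartesianProduct pairs pairs)
      pairs! : Unique pairs
      pairs! = cartesianProduct⁺ (allFin⁺ 3) (allFin⁺ 3)
      ⊆cycles : ∀ {r} → r ∈ map hexagon crossing → r ∈ proj₁ hexagons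
      ⊆cycles r∈ with ∈-map⁻ hexagon r∈
      ... | (p , q) , t∈ , refl = Equivalence.to (proj₁ (proj₂ (proj₂ hexagons)) (hexagon (p , q)))
        (hexagon-cycle p q (proj₂ (∈-filter⁻ adjacent? {xs = cartesianProduct pairs pairs} t∈)))

    tree-bound : ∑[ t ∈ nodes ] leafDegree (vertex t) ≤ 18 + (l + l)
    tree-bound = begin
      ∑[ t ∈ nodes ] leafDegree (vertex t)
        ≡⟨ cong (λ s → leafDegree x + (leafDegree y + s)) regroup ⟩
      leafDegree x + (leafDegree y + (children X.P + (children Y.P + (crossEdges + crossEdges))))
        ≤⟨ ℕ.+-mono-≤ leafDegree-x (ℕ.+-mono-≤ leafDegree-y
             (ℕ.+-mono-≤ (∑-mono (allFin 3) leafDegree-childˣ)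
               (ℕ.+-mono-≤ (∑-mono (allFin 3) leafDegree-childʸ) (ℕ.+-mono-≤ crossEdges≤l crossEdges≤l)))) ⟩
      18 + (l + l) ∎
      where
      open ℕ.≤-Reasoning
      f : Node → ℕ
      f = leafDegree ∘ vertex
      children : (Fin 3 → Fin n) → ℕ
      children P = ∑[ i ∈ allFin 3 ] leafDegree (P i)
      regroup : ∑ (map childˣ (allFin 3) ++ map childʸ (allFin 3) ++ leafNodes) f
              ≡ children X.P + (children Y.P + (crossEdges + crossEdges))
      regroup =
        trans (∑-++ (map childˣ (allFin 3)) (map childʸ (allFin 3) ++ leafNodes) f)
              (cong₂ _+_ (∑-map childˣ (allFin 3) f)
        (trans (∑-++ (map childʸ (allFin 3)) leafNodes f)
               (cong₂ _+_ (∑-map childʸ (allFin 3) f)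
        (trans (∑-++ (map leafˣ pairs) (map leafʸ pairs) f)
               (cong₂ _+_ (trans (∑-map leafˣ pairs f) leafDegree-leavesˣ)
                          (trans (∑-map leafʸ pairs f) leafDegree-leavesʸ))))))

    leafDegree-total : ∑[ v ∈ allFin n ] leafDegree v ≡ 72
    leafDegree-total = begin
      ∑[ v ∈ allFin n ] ∑[ w ∈ map vertex leafNodes ] edge v w ≡⟨ ∑-swap (allFin n) (map vertex leafNodes) edge ⟩
      ∑[ w ∈ map vertex leafNodes ] ∑[ v ∈ allFin n ] edge v w ≡⟨ ∑-cong (map vertex leafNodes) degree′ ⟩
      ∑[ w ∈ map vertex leafNodes ] 4                           ≡⟨ ∑-const (map vertex leafNodes) 4 ⟩
      72                                                        ∎
      where
      open ≡-Reasoning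
      degree′ : ∀ w → ∑[ v ∈ allFin n ] edge v w ≡ 4
      degree′ w = trans (∑-cong (allFin n) (λ v → edge-sym v w)) (degree w)

    inTree : Fin n → Bool
    inTree v = does (v ∈? map vertex nodes)

    outside : (Fin n → ℕ) → ℕ
    outside h = ∑[ v ∈ allFin n ] (if inTree v then 0 else h v)

    inside : ∀ h → ∑[ v ∈ allFin n ] (if inTree v then h v else 0) ≡ ∑[ t ∈ nodes ] h (vertex t)
    inside h = trans (∑-allFin-∈ (distinct nodes refl) h) (∑-map vertex nodes h)

    inside-4 : ∑[ v ∈ allFin n ] (if inTree v then 4 else 0) ≡ 104
    inside-4 = inside (λ _ → 4)

    outside-4 : 104 + outside (λ _ → 4) ≡ n * 4
    outside-4 = begin
      104 + outside (λ _ → 4)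
        ≡⟨ cong (_+ outside (λ _ → 4)) (sym inside-4) ⟩
      ∑[ v ∈ allFin n ] (if inTree v then 4 else 0) + outside (λ _ → 4)
        ≡⟨ sym (∑-partition (allFin n) (λ _ → 4) inTree) ⟩
      ∑[ _ ∈ allFin n ] 4
        ≡⟨ ∑-const (allFin n) 4 ⟩
      length (allFin n) * 4
        ≡⟨ cong (_* 4) (List.length-tabulate {n = n} id) ⟩
      n * 4 ∎
      where open ≡-Reasoning

    leafDegree-bound : 72 ≤ 18 + (l + l) + outside (λ _ → 4)
    leafDegree-bound = begin
      72
        ≡⟨ sym leafDegree-total ⟩
      ∑[ v ∈ allFin n ] leafDegree v
        ≡⟨ ∑-partition (allFin n) leafDegree inTree ⟩
      ∑[ v ∈ allFin n ] (if inTree v then leafDegree v else 0) + outside leafDegree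
        ≤⟨ ℕ.+-mono-≤ (ℕ.≤-reflexive (inside leafDegree))
                      (∑-mono (allFin n) λ v → if-mono (inTree v) (degreeIn≤4 v (distinct leafNodes refl))) ⟩
      ∑[ t ∈ nodes ] leafDegree (vertex t) + outside (λ _ → 4)
        ≤⟨ ℕ.+-monoˡ-≤ (outside (λ _ → 4)) tree-bound ⟩
      18 + (l + l) + outside (λ _ → 4) ∎
      where
      open ℕ.≤-Reasoning
      if-mono : ∀ b {m m′} → m ≤ m′ → (if b then 0 else m) ≤ (if b then 0 else m′)
      if-mono true  _ = z≤n
      if-mono false p = p

    bound : 79 ≤ l + 2 * n
    bound = ℕ.*-cancelˡ-≤ 2 (ℕ.+-cancelˡ-≤ 18 (2 * 79) (2 * (l + 2 * n)) (begin
      72 + 104                            ≤⟨ ℕ.+-monoˡ-≤ 104 leafDegree-bound ⟩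
      18 + (l + l) + r + 104              ≡⟨ regroup l r ⟩
      18 + ((l + l) + (104 + r))          ≡⟨ cong (λ s → 18 + ((l + l) + s)) outside-4 ⟩
      18 + ((l + l) + n * 4)              ≡⟨ cong (18 +_) (double l n) ⟩
      18 + 2 * (l + 2 * n)                ∎))
      where
      open ℕ.≤-Reasoning
      r : ℕ
      r = outside (λ _ → 4)
      regroup : ∀ l r → 18 + (l + l) + r + 104 ≡ 18 + ((l + l) + (104 + r))
      regroup = solve-∀
      double : ∀ l n → (l + l) + n * 4 ≡ 2 * (l + 2 * n)
      double = solve-∀

egr⇒79≤l+2n : ∀ {n l} {G : Graph n} → IsEGR G 4 6 l → 79 ≤ l + 2 * n
egr⇒79≤l+2n {G = G} (_ , regular , ((c , cycle) , girth) , edgeRegular) =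
  LowerBound.Tree.bound G regular girth xy (edgeRegular _ _ xy)
  where
  xy : Adj G (lookup c zero) (lookup c (suc zero))
  xy = IsCycle.consec cycle zero (suc zero) refl

-- Graphs given by adjacency lists

splice : ∀ {A : Set} → Vec A 2 → Vec A 2 → Vec A 4
splice (a ∷ b ∷ []) (d ∷ c ∷ []) = a ∷ b ∷ c ∷ d ∷ []

splice-injective : ∀ {A : Set} {u u′ v v′ : Vec A 2} →
                   splice u v ≡ splice u′ v′ → u ≡ u′ × v ≡ v′
splice-injective {u = _ ∷ _ ∷ []} {_ ∷ _ ∷ []} {_ ∷ _ ∷ []} {_ ∷ _ ∷ []} refl = refl , refl

listed : ∀ {n} → (Fin n → List (Fin n)) → Fin n → Fin n → Bool
listed N x y = ⌊ Any.any? (y Fin.≟_) (N x) ⌋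

module AdjacencyLists {n : ℕ} (N : Fin n → List (Fin n))
  (symmetric : ∀ x y → listed N x y ≡ listed N y x)
  (loopless : ∀ x → listed N x x ≡ false)
  (duplicate-free : ∀ x → Unique (N x))
  where

  graph : Graph n
  graph = record { adj = listed N ; sym = symmetric ; irrefl = loopless }

  Adj⇒∈ : ∀ {x y} → Adj graph x y → y ∈ N x
  Adj⇒∈ {x} {y} = toWitness {a? = Any.any? (y Fin.≟_) (N x)}

  ∈⇒Adj : ∀ {x y} → y ∈ N x → Adj graph x y
  ∈⇒Adj = fromWitness

  regular : ∀ {k} → (∀ x → length (N x) ≡ k) → Regular graph k
  regular degree x = N x , duplicate-free x , (λ y → mk⇔ Adj⇒∈ ∈⇒Adj) , degree x

  reachableWithin : ℕ → Fin n → Fin n → Bool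
  reachableWithin zero    x y = ⌊ x Fin.≟ y ⌋
  reachableWithin (suc k) x y = ⌊ x Fin.≟ y ⌋ ∨ any (λ z → reachableWithin k z y) (N x)

  reachableWithin-sound : ∀ k x y → T (reachableWithin k x y) → Reachable graph x y
  reachableWithin-sound zero x y found with x Fin.≟ y
  ... | yes refl = here
  reachableWithin-sound (suc k) x y found with x Fin.≟ y
  ... | yes refl = here
  ... | no _ with find (any⁻ _ (N x) found)
  ... | z , z∈ , zy = step (∈⇒Adj z∈) (reachableWithin-sound k z y zy)

  -- p is the vertex from which the walk arrived at x.
  nonBacktracking : ∀ k → Fin n → Fin n → List (Vec (Fin n) k)
  nonBacktracking zero    p x = [] ∷ []
  nonBacktracking (suc k) p x =
    concatMap (λ y → map (y ∷_) (nonBacktracking k x y)) (filter (λ y → ¬? (y Fin.≟ p)) (N x))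

  ∈-nonBacktracking : ∀ {k p x} {w : Vec (Fin n) k} → Linked (Adj graph) (x ∷ w) → Uniqueᵛ (x ∷ w) →
                      VecAll.All (p ≢_) w → w ∈ nonBacktracking k p x
  ∈-nonBacktracking {w = []}    _         _                 _         = Any.here refl
  ∈-nonBacktracking {w = _ ∷ _} (xy ∷ yw) ((_ ∷ x∉w) ∷ yw!) (p≢y ∷ _) =
    ∈-concatMap⁺ _ (lose (∈-filter⁺ _ (Adj⇒∈ xy) (p≢y ∘ sym))
                         (∈-map⁺ _ (∈-nonBacktracking yw yw! x∉w)))

  nonBacktracking⇒Linked : ∀ {k p x} {w : Vec (Fin n) k} →
                           w ∈ nonBacktracking k p x → Linked (Adj graph) (x ∷ w)
  nonBacktracking⇒Linked {zero}  {w = []} _ = [-]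
  nonBacktracking⇒Linked {suc k} {p} {x} w∈
    with find (∈-concatMap⁻ _ {xs = filter (λ y → ¬? (y Fin.≟ p)) (N x)} w∈)
  ... | y , y∈ , w∈y with ∈-map⁻ _ w∈y
  ... | _ , w′∈ , refl = ∈⇒Adj (proj₁ (∈-filter⁻ _ {xs = N x} y∈)) ∷ nonBacktracking⇒Linked w′∈

  nonBacktracking-unique : ∀ k p x → Unique (nonBacktracking k p x)
  nonBacktracking-unique zero    p x = [] ∷ []
  nonBacktracking-unique (suc k) p x =
    concat⁺ (All.map⁺ (All.tabulate λ {y} _ → Unique-map⁺ Vec.∷-injectiveʳ (nonBacktracking-unique k x y)))
            (AllPairs.map⁺ (AllPairs.map disjoint (filter⁺ _ (duplicate-free x))))
    where
    disjoint : ∀ {y z} → y ≢ z →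
               Disjoint (map (y ∷_) (nonBacktracking k x y)) (map (z ∷_) (nonBacktracking k x z))
    disjoint y≢z (p , q) with ∈-map⁻ _ p | ∈-map⁻ _ q
    ... | _ , _ , refl | _ , _ , e = y≢z (Vec.∷-injectiveˡ e)

  ClosesCycle : ∀ {k} → Fin n → Vec (Fin n) (suc k) → Set
  ClosesCycle x w = Uniqueᵛ (x ∷ w) × Adj graph (last w) x

  closesCycle? : ∀ {k} x (w : Vec (Fin n) (suc k)) → Dec (ClosesCycle x w)
  closesCycle? x w = allPairs? (λ u v → ¬? (u Fin.≟ v)) (x ∷ w) ×-dec adj? graph (last w) x

  noCycleOfLength : ∀ k →
    all (λ x → all (λ w → not ⌊ closesCycle? x w ⌋) (nonBacktracking (2 + k) x x)) (allFin n) ≡ true →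
    NoCycleOfLength graph (3 + k)
  noCycleOfLength k none (x ∷ w) cycle with IsCycle-elim graph cycle
  ... | x∷w!@(x∉w ∷ _) , linked , closing =
    toWitnessFalse (all-true (Equivalence.to Bool.T-≡ (all-true none (∈-allFin x)))
                             (∈-nonBacktracking linked x∷w! x∉w))
                   (x∷w! , closing)

  -- The hexagon x y a b c d is found from the walks y a b and x d c.
  hexagonCandidates : Fin n → Fin n → List (Vec (Fin n) 4)
  hexagonCandidates x y = cartesianProductWith splice (nonBacktracking 2 x y) (nonBacktracking 2 y x)

  ClosesHexagon : Fin n → Fin n → Vec (Fin n) 4 → Set
  ClosesHexagon x y r@(_ ∷ b ∷ c ∷ _ ∷ []) = Uniqueᵛ (x ∷ y ∷ r) × Adj graph b c

  closesHexagon? : ∀ x y r → Dec (ClosesHexagon x y r)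
  closesHexagon? x y r@(_ ∷ b ∷ c ∷ _ ∷ []) =
    allPairs? (λ u v → ¬? (u Fin.≟ v)) (x ∷ y ∷ r) ×-dec adj? graph b c

  hexagon⇔ : ∀ {x y} → Adj graph x y → ∀ r →
             IsCycle graph (x ∷ y ∷ r) ⇔ (r ∈ hexagonCandidates x y × ClosesHexagon x y r)
  hexagon⇔ {x} {y} xy r@(_ ∷ _ ∷ _ ∷ _ ∷ []) = mk⇔ to from
    where
    to : IsCycle graph (x ∷ y ∷ r) → r ∈ hexagonCandidates x y × ClosesHexagon x y r
    to cycle with IsCycle-elim graph cycle
    ... | unique@((_ ∷ x≢a ∷ x≢b ∷ x≢c ∷ x≢d ∷ []) ∷ (y≢a ∷ y≢b ∷ y≢c ∷ y≢d ∷ []) ∷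
                  (a≢b ∷ _) ∷ _ ∷ (c≢d ∷ []) ∷ [] ∷ [])
        , _ ∷ ya ∷ ab ∷ bc ∷ cd ∷ [-] , dx =
      ∈-cartesianProductWith⁺ splice
        (∈-nonBacktracking (ya ∷ ab ∷ [-]) ((y≢a ∷ y≢b ∷ []) ∷ (a≢b ∷ []) ∷ [] ∷ []) (x≢a ∷ x≢b ∷ []))
        (∈-nonBacktracking (Adj-sym graph dx ∷ Adj-sym graph cd ∷ [-])
                           ((x≢d ∷ x≢c ∷ []) ∷ (≢-sym c≢d ∷ []) ∷ [] ∷ []) (y≢d ∷ y≢c ∷ [])) ,
      unique , bc
    from : r ∈ hexagonCandidates x y × ClosesHexagon x y r → IsCycle graph (x ∷ y ∷ r)
    from (r∈ , closes) with ∈-cartesianProductWith⁻ splice (nonBacktracking 2 x y) (nonBacktracking 2 y x) r∈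
    ... | a ∷ b ∷ [] , d ∷ c ∷ [] , ab∈ , dc∈ , refl
        with nonBacktracking⇒Linked ab∈ | nonBacktracking⇒Linked dc∈ | closes
    ... | ya ∷ ab ∷ [-] | xd ∷ dc ∷ [-] | unique , bc =
      IsCycle-intro graph unique (xy ∷ ya ∷ ab ∷ bc ∷ Adj-sym graph dc ∷ [-]) (Adj-sym graph xd)

  hexagons : Fin n → Fin n → List (Vec (Fin n) 4)
  hexagons x y = filter (closesHexagon? x y) (hexagonCandidates x y)

  edgeRegular : ∀ {l} → (∀ x y → Adj graph x y → length (hexagons x y) ≡ l) → EdgeRegular graph 6 l
  edgeRegular count x y xy = subst (HasExactly _) (count x y xy)
    (HasExactly-filter (closesHexagon? x y)
      (cartesianProductWith⁺ splice splice-injective (nonBacktracking-unique 2 x y) (nonBacktracking-unique 2 y x))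
      (hexagon⇔ xy))

-- The odd graph O₄

-- Vertex i is the i-th 3-element subset of {0, …, 6} in lexicographic order; its neighbours are
-- the four 3-element subsets of its complement.
kneserNeighbours : Fin 35 → List (Fin 35)
kneserNeighbours = lookup
  ( (# 31 ∷ # 32 ∷ # 33 ∷ # 34 ∷ [])
  ∷ (# 28 ∷ # 29 ∷ # 30 ∷ # 34 ∷ [])
  ∷ (# 26 ∷ # 27 ∷ # 30 ∷ # 33 ∷ [])
  ∷ (# 25 ∷ # 27 ∷ # 29 ∷ # 32 ∷ [])
  ∷ (# 25 ∷ # 26 ∷ # 28 ∷ # 31 ∷ [])
  ∷ (# 22 ∷ # 23 ∷ # 24 ∷ # 34 ∷ [])
  ∷ (# 20 ∷ # 21 ∷ # 24 ∷ # 33 ∷ [])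
  ∷ (# 19 ∷ # 21 ∷ # 23 ∷ # 32 ∷ [])
  ∷ (# 19 ∷ # 20 ∷ # 22 ∷ # 31 ∷ [])
  ∷ (# 17 ∷ # 18 ∷ # 24 ∷ # 30 ∷ [])
  ∷ (# 16 ∷ # 18 ∷ # 23 ∷ # 29 ∷ [])
  ∷ (# 16 ∷ # 17 ∷ # 22 ∷ # 28 ∷ [])
  ∷ (# 15 ∷ # 18 ∷ # 21 ∷ # 27 ∷ [])
  ∷ (# 15 ∷ # 17 ∷ # 20 ∷ # 26 ∷ [])
  ∷ (# 15 ∷ # 16 ∷ # 19 ∷ # 25 ∷ [])
  ∷ (# 12 ∷ # 13 ∷ # 14 ∷ # 34 ∷ [])
  ∷ (# 10 ∷ # 11 ∷ # 14 ∷ # 33 ∷ [])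
  ∷ (# 9 ∷ # 11 ∷ # 13 ∷ # 32 ∷ [])
  ∷ (# 9 ∷ # 10 ∷ # 12 ∷ # 31 ∷ [])
  ∷ (# 7 ∷ # 8 ∷ # 14 ∷ # 30 ∷ [])
  ∷ (# 6 ∷ # 8 ∷ # 13 ∷ # 29 ∷ [])
  ∷ (# 6 ∷ # 7 ∷ # 12 ∷ # 28 ∷ [])
  ∷ (# 5 ∷ # 8 ∷ # 11 ∷ # 27 ∷ [])
  ∷ (# 5 ∷ # 7 ∷ # 10 ∷ # 26 ∷ [])
  ∷ (# 5 ∷ # 6 ∷ # 9 ∷ # 25 ∷ [])
  ∷ (# 3 ∷ # 4 ∷ # 14 ∷ # 24 ∷ [])
  ∷ (# 2 ∷ # 4 ∷ # 13 ∷ # 23 ∷ [])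
  ∷ (# 2 ∷ # 3 ∷ # 12 ∷ # 22 ∷ [])
  ∷ (# 1 ∷ # 4 ∷ # 11 ∷ # 21 ∷ [])
  ∷ (# 1 ∷ # 3 ∷ # 10 ∷ # 20 ∷ [])
  ∷ (# 1 ∷ # 2 ∷ # 9 ∷ # 19 ∷ [])
  ∷ (# 0 ∷ # 4 ∷ # 8 ∷ # 18 ∷ [])
  ∷ (# 0 ∷ # 3 ∷ # 7 ∷ # 17 ∷ [])
  ∷ (# 0 ∷ # 2 ∷ # 6 ∷ # 16 ∷ [])
  ∷ (# 0 ∷ # 1 ∷ # 5 ∷ # 15 ∷ [])
  ∷ [])

module Kneser = AdjacencyLists kneserNeighbours
  (∀₂-byEvaluation (λ x y → listed kneserNeighbours x y Bool.≟ listed kneserNeighbours y x) refl)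
  (∀-byEvaluation (λ x → listed kneserNeighbours x x Bool.≟ false) refl)
  (∀-byEvaluation (λ x → UniqueDec.unique? Fin._≟_ (kneserNeighbours x)) refl)

kneser : Graph 35
kneser = Kneser.graph

kneser-connected : Connected kneser
kneser-connected = connected kneser λ x →
  Kneser.reachableWithin-sound 3 x zero (∀-byEvaluation (λ x → T? (Kneser.reachableWithin 3 x zero)) refl x)

kneser-regular : Regular kneser 4
kneser-regular = Kneser.regular (∀-byEvaluation (λ x → length (kneserNeighbours x) ≟ 4) refl)

kneser-girth : HasGirth kneser 6
kneser-girth = (_ , byEvaluation (isCycle? kneser (# 0 ∷ # 34 ∷ # 15 ∷ # 14 ∷ # 16 ∷ # 33 ∷ [])) refl) ,
               girth≥ kneser 6 short
  where
  short : ∀ k → 3 + k < 6 → NoCycleOfLength kneser (3 + k)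
  short 0 _ = Kneser.noCycleOfLength 0 refl
  short 1 _ = Kneser.noCycleOfLength 1 refl
  short 2 _ = Kneser.noCycleOfLength 2 refl
  short (suc (suc (suc k))) (s≤s (s≤s (s≤s (s≤s (s≤s (s≤s ()))))))

kneser-edgeRegular : EdgeRegular kneser 6 9
kneser-edgeRegular = Kneser.edgeRegular
  (∀₂-byEvaluation (λ x y → adj? kneser x y →-dec (length (Kneser.hexagons x y) ≟ 9)) refl)

mainTheorem7 : nEGR≡ 4 6 9 35
mainTheorem7 = (kneser , kneser-connected , kneser-regular , kneser-girth , kneser-edgeRegular) , tooSmall
  where
  tooSmall : ∀ w → w < 35 → ¬ EGRExists w 4 6 9
  tooSmall w w<35 (_ , egr) =
    from-no (79 ≤? 77)
            (ℕ.≤-trans (egr⇒79≤l+2n egr) (ℕ.+-monoʳ-≤ 9 (ℕ.*-monoʳ-≤ 2 (ℕ.≤-pred w<35))))
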